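{- For every $n\ge0$, in $\mathbb Z[x,q]$, $$L_n(x)+q\bar L_n(x)\equiv r_n(x,q)\pmod{q^2-1}\quad\text{and}\quad e_n(x)+q\,o_n(x)\equiv p_n(x,q)\pmod{q^2-1},$$ where $r_n(x,q)=\sum_{k=0}^n\begin{bmatrix}n\\k\end{bmatrix}_q x^k$ is the Rogers–Szegő polynomial and $p_n(x,q)=\prod_{j=1}^n(1+q^jx)=\sum_{k=0}^n q^{\binom{k+1}{2}}\begin{bmatrix}n\\k\end{bmatrix}_q x^k$.
   Context: $e(n,k)$ (resp. $o(n,k)$) is the number of $k$-subsets of $\{1,\dots,n\}$ whose element sum is even (resp. odd), the empty set counting as even; $e_n(x)=\sum_k e(n,k)x^k$, $o_n(x)=\sum_k o(n,k)x^k$. $\begin{bmatrix}n\\k\end{bmatrix}_q$ is the Gaussian binomial coefficient. Losanitsch's triangle is defined by $L(0,j)=[j=0]$, $L(1,j)=[0\le j\le 1]$, $L(m,j)=0$ for $j<0$, and for $m\ge 2$ by $L(m,j)=L(m-2,j)+\binom{m-2}{j-1}+L(m-2,j-2)$ (with $\binom{a}{i}=0$ for $i<0$ or $i>a$); $\bar L(n,k)=\binom nk-L(n,k)$, $L_n(x)=\sum_{k=0}^nL(n,k)x^k$, $\bar L_n(x)=\sum_{k=0}^n\bar L(n,k)x^k$. -}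

module Defs where

open import Data.Nat as ℕ using (ℕ; zero; suc)
open import Data.Nat.Combinatorics using (_C_)
open import Data.Integer as ℤ using (ℤ; +_; -_)
open import Data.List using (List; []; _∷_; map; replicate; _++_; length; filter; upTo; foldr)
open import Data.Nat.ListAction using (sum)
open import Data.Product using (∃; _×_)
open import Relation.Binary.PropositionalEquality using (_≡_)
open import Relation.Nullary.Decidable using (_×-dec_)
open import Data.Nat.Properties using (_≟_)

-- Univariate polynomials in q with integer coefficients
-- (coefficient lists, lowest degree first; equality is taken
--  coefficientwise, so trailing zeros are irrelevant).

Poly : Set
Poly = List ℤ

coeff : Poly → ℕ → ℤ
coeff []       _       = + 0
coeff (a ∷ _)  zero    = a
coeff (_ ∷ f)  (suc i) = coeff f i

infixl 6 _⊕_
infixl 7 _⊗_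

_⊕_ : Poly → Poly → Poly
[]      ⊕ g       = g
(a ∷ f) ⊕ []      = a ∷ f
(a ∷ f) ⊕ (b ∷ g) = (a ℤ.+ b) ∷ (f ⊕ g)

scale : ℤ → Poly → Poly
scale c = map (c ℤ.*_)

_⊗_ : Poly → Poly → Poly
[]      ⊗ g = []
(a ∷ f) ⊗ g = scale a g ⊕ (+ 0 ∷ (f ⊗ g))

const : ℤ → Poly
const c = c ∷ []

qpow : ℕ → Poly
qpow j = replicate j (+ 0) ++ (+ 1 ∷ [])

-- Bivariate polynomials: ℤ[x,q] = ℤ[q][x], i.e. lists (in powers of x)
-- of polynomials in q.

Poly2 : Set
Poly2 = List Poly

coeff2 : Poly2 → ℕ → ℕ → ℤ
coeff2 []       _       j = + 0
coeff2 (f ∷ _)  zero    j = coeff f j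
coeff2 (_ ∷ F)  (suc k) j = coeff2 F k j

infixl 6 _⊕₂_
infixl 7 _⊗₂_

_⊕₂_ : Poly2 → Poly2 → Poly2
[]      ⊕₂ G       = G
(f ∷ F) ⊕₂ []      = f ∷ F
(f ∷ F) ⊕₂ (g ∷ G) = (f ⊕ g) ∷ (F ⊕₂ G)

scale₂ : Poly → Poly2 → Poly2
scale₂ c = map (c ⊗_)

_⊗₂_ : Poly2 → Poly2 → Poly2
[]      ⊗₂ G = []
(f ∷ F) ⊗₂ G = scale₂ f G ⊕₂ ([] ∷ (F ⊗₂ G))

q²-1 : Poly2
q²-1 = (- + 1 ∷ + 0 ∷ + 1 ∷ []) ∷ []

_≡_[mod-q²-1] : Poly2 → Poly2 → Set
F ≡ G [mod-q²-1] = ∃ λ (H : Poly2) → ∀ k j → coeff2 F k j ≡ coeff2 (G ⊕₂ q²-1 ⊗₂ H) k j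

xsum : ℕ → (ℕ → Poly) → Poly2
xsum n c = map c (upTo (suc n))

gauss : ℕ → ℕ → Poly
gauss n       zero    = const (+ 1)
gauss zero    (suc k) = []
gauss (suc n) (suc k) = gauss n k ⊕ qpow (suc k) ⊗ gauss n (suc k)

rogersSzego : ℕ → Poly2
rogersSzego n = xsum n (gauss n)

pPoly : ℕ → Poly2
pPoly zero    = const (+ 1) ∷ []
pPoly (suc n) = pPoly n ⊗₂ (const (+ 1) ∷ qpow (suc n) ∷ [])

subsets : ℕ → List (List ℕ)
subsets zero    = [] ∷ []
subsets (suc n) = subsets n ++ map (suc n ∷_) (subsets n)

e : ℕ → ℕ → ℕ
e n k = length (filter (λ s → (length s ≟ k) ×-dec (sum s ℕ.% 2 ≟ 0)) (subsets n))

o : ℕ → ℕ → ℕ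
o n k = length (filter (λ s → (length s ≟ k) ×-dec (sum s ℕ.% 2 ≟ 1)) (subsets n))

eoPoly : ℕ → Poly2
eoPoly n = xsum n (λ k → + e n k ∷ + o n k ∷ [])

L : ℕ → ℕ → ℕ
L zero          zero          = 1
L zero          (suc j)       = 0
L (suc zero)    zero          = 1
L (suc zero)    (suc zero)    = 1
L (suc zero)    (suc (suc j)) = 0
L (suc (suc m)) zero          = L m zero
L (suc (suc m)) (suc zero)    = L m 1 ℕ.+ (m C 0)
L (suc (suc m)) (suc (suc j)) = L m (suc (suc j)) ℕ.+ (m C suc j) ℕ.+ L m j

Lbar : ℕ → ℕ → ℤ
Lbar n k = + (n C k) ℤ.- + L n k

LPoly : ℕ → Poly2
LPoly n = xsum n (λ k → + L n k ∷ Lbar n k ∷ [])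

module Submission where

-- The ring ℤ[q]/(q² - 1) is isomorphic to ℤ × ℤ: a polynomial
-- f(q) is sent to its "residue" (sum of even coefficients, sum of odd
-- coefficients), i.e. to the reduced form a + b·q.  This residue map is a ring
-- homomorphism whose kernel is exactly the ideal (q² - 1), so two bivariate
-- polynomials are congruent modulo q² - 1 as soon as the coefficients of
-- every power x^k have equal residues.  The theorem thus reduces to two
-- coefficient computations in ℤ × ℤ, where q^m acts as the identity or as the
-- coordinate swap according to the parity of m:
--  * the residue of [n k]_q is (L(n,k), L̄(n,k)): applying the q-Pascal rule
--    twice and using q² = 1 gives exactly Losanitsch's recurrence;
--  * the residue of the x^k coefficient of p_n = ∏ (1 + q^j x) is the tally
--    Σ_{|s| = k} q^{Σ s} over the subsets s of {1,…,n}, whose coordinates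
--    count the k-subsets with even and with odd element sum.

open import Defs
open import Data.Nat as ℕ using (ℕ; zero; suc; _<_; _≤_; s≤s; _≤?_; _%_; _≡ᵇ_)
open import Data.Nat.Properties using (_≟_; ≰⇒>; m<n⇒m<1+n)
open import Data.Nat.DivMod using (m%n<n)
open import Data.Nat.Combinatorics using (_C_; nC1≡n; nCk+nC[k+1]≡[n+1]C[k+1])
open import Data.Nat.ListAction using (sum)
open import Data.Integer using (ℤ; +_; -_; _+_; _-_; _*_)
open import Data.Integer.Properties using (+-identityˡ; +-identityʳ; +-comm; *-zeroʳ; *-distribˡ-+; pos-+)
open import Data.Integer.Tactic.RingSolver using (solve-∀)
open import Data.Bool using (true; false; if_then_else_)
open import Data.List using (List; []; _∷_; map; drop; _++_; length; filter; applyUpTo)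
open import Data.Product using (_×_; _,_; proj₁; proj₂)
open import Relation.Nullary using (yes; no)
open import Relation.Nullary.Decidable using (_×-dec_)
open import Relation.Binary.PropositionalEquality
open ≡-Reasoning

coeff-⊕ : ∀ f g j → coeff (f ⊕ g) j ≡ coeff f j + coeff g j
coeff-⊕ []      g       j       = sym (+-identityˡ _)
coeff-⊕ (a ∷ f) []      j       = sym (+-identityʳ _)
coeff-⊕ (a ∷ f) (b ∷ g) zero    = refl
coeff-⊕ (a ∷ f) (b ∷ g) (suc j) = coeff-⊕ f g j

coeff-scale : ∀ c g j → coeff (scale c g) j ≡ c * coeff g j
coeff-scale c []      j       = sym (*-zeroʳ c)
coeff-scale c (a ∷ g) zero    = refl
coeff-scale c (a ∷ g) (suc j) = coeff-scale c g j

coeff-cons-⊗ : ∀ a f h j → coeff ((a ∷ f) ⊗ h) j ≡ a * coeff h j + coeff (+ 0 ∷ f ⊗ h) j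
coeff-cons-⊗ a f h j =
  trans (coeff-⊕ (scale a h) _ j) (cong (_+ coeff (+ 0 ∷ f ⊗ h) j) (coeff-scale a h j))

coeff2-⊕₂ : ∀ A B k j → coeff2 (A ⊕₂ B) k j ≡ coeff2 A k j + coeff2 B k j
coeff2-⊕₂ []      B       k       j = sym (+-identityˡ _)
coeff2-⊕₂ (f ∷ A) []      k       j = sym (+-identityʳ _)
coeff2-⊕₂ (f ∷ A) (g ∷ B) zero    j = coeff-⊕ f g j
coeff2-⊕₂ (f ∷ A) (g ∷ B) (suc k) j = coeff2-⊕₂ A B k j

row : Poly2 → ℕ → Poly
row []      k       = []
row (f ∷ F) zero    = f
row (f ∷ F) (suc k) = row F k

coeff2-row : ∀ F k j → coeff2 F k j ≡ coeff (row F k) j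
coeff2-row []      k       j = refl
coeff2-row (f ∷ F) zero    j = refl
coeff2-row (f ∷ F) (suc k) j = coeff2-row F k j

-- The residue ring ℤ[q]/(q² - 1) ≅ ℤ × ℤ; the pair (a , b) stands for a + b·q

Residue : Set
Residue = ℤ × ℤ

0ᵣ 1ᵣ : Residue
0ᵣ = + 0 , + 0
1ᵣ = + 1 , + 0

infixl 6 _⊞_
infixl 7 _⊠_ _·ᵣ_

-- ring operations: (a + bq)(c + dq) = (ac + bd) + (ad + bc)q since q² = 1
_⊞_ : Residue → Residue → Residue
(a , b) ⊞ (c , d) = a + c , b + d

_⊠_ : Residue → Residue → Residue
(a , b) ⊠ (c , d) = a * c + b * d , a * d + b * c

_·ᵣ_ : ℤ → Residue → Residue
c ·ᵣ (a , b) = c * a , c * b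

-- multiplication by q swaps the two coordinates
swap : Residue → Residue
swap (a , b) = b , a

-- multiplication by q^m; as q² = 1, only the parity of m matters
qmul : ℕ → Residue → Residue
qmul zero          u = u
qmul (suc zero)    u = swap u
qmul (suc (suc m)) u = qmul m u

-- the value at q = 1, and the element t·(1 + q)
total : Residue → ℤ
total (a , b) = a + b

diag : ℤ → Residue
diag t = t , t

⊞-identityˡ : ∀ u → 0ᵣ ⊞ u ≡ u
⊞-identityˡ (a , b) = cong₂ _,_ (+-identityˡ a) (+-identityˡ b)

⊞-identityʳ : ∀ u → u ⊞ 0ᵣ ≡ u
⊞-identityʳ (a , b) = cong₂ _,_ (+-identityʳ a) (+-identityʳ b)

⊞-assoc : ∀ u v w → u ⊞ v ⊞ w ≡ u ⊞ (v ⊞ w)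
⊞-assoc (a , b) (c , d) (e , f) = cong₂ _,_ (assoc a c e) (assoc b d f)
  where assoc : ∀ x y z → x + y + z ≡ x + (y + z)
        assoc = solve-∀

⊞-comm : ∀ u v → u ⊞ v ≡ v ⊞ u
⊞-comm (a , b) (c , d) = cong₂ _,_ (+-comm a c) (+-comm b d)

⊠-comm : ∀ u v → u ⊠ v ≡ v ⊠ u
⊠-comm (a , b) (c , d) = cong₂ _,_ (comm₀ a b c d) (comm₁ a b c d)
  where comm₀ : ∀ a b c d → a * c + b * d ≡ c * a + d * b
        comm₀ = solve-∀
        comm₁ : ∀ a b c d → a * d + b * c ≡ c * b + d * a
        comm₁ = solve-∀

⊠-zeroˡ : ∀ u → 0ᵣ ⊠ u ≡ 0ᵣ
⊠-zeroˡ (a , b) = cong₂ _,_ (annihilate a b) (annihilate b a)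
  where annihilate : ∀ a b → + 0 * a + + 0 * b ≡ + 0
        annihilate = solve-∀

qmul-suc : ∀ m u → qmul (suc m) u ≡ swap (qmul m u)
qmul-suc zero          u = refl
qmul-suc (suc zero)    u = refl
qmul-suc (suc (suc m)) u = qmul-suc m u

qmul-+ : ∀ a t u → qmul (a ℕ.+ t) u ≡ qmul a (qmul t u)
qmul-+ zero          t u = refl
qmul-+ (suc zero)    t u = qmul-suc t u
qmul-+ (suc (suc a)) t u = qmul-+ a t u

qmul-mod2 : ∀ t u → qmul t u ≡ qmul (t % 2) u
qmul-mod2 zero          u = refl
qmul-mod2 (suc zero)    u = refl
qmul-mod2 (suc (suc t)) u = qmul-mod2 t u

qmul-⊞ : ∀ m u v → qmul m (u ⊞ v) ≡ qmul m u ⊞ qmul m v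
qmul-⊞ zero          u v = refl
qmul-⊞ (suc zero)    u v = refl
qmul-⊞ (suc (suc m)) u v = qmul-⊞ m u v

qmul-0ᵣ : ∀ m → qmul m 0ᵣ ≡ 0ᵣ
qmul-0ᵣ zero          = refl
qmul-0ᵣ (suc zero)    = refl
qmul-0ᵣ (suc (suc m)) = qmul-0ᵣ m

qmul-involutive : ∀ m u → qmul m (qmul m u) ≡ u
qmul-involutive zero          u = refl
qmul-involutive (suc zero)    u = refl
qmul-involutive (suc (suc m)) u = qmul-involutive m u

-- q^m·u + q^{m+1}·u = (1 + q)·u = total(u)·(1 + q)
qmul-+-qmul-suc : ∀ m u → qmul m u ⊞ qmul (suc m) u ≡ diag (total u)
qmul-+-qmul-suc zero          (a , b) = cong (a + b ,_) (+-comm b a)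
qmul-+-qmul-suc (suc zero)    (a , b) = cong (_, a + b) (+-comm b a)
qmul-+-qmul-suc (suc (suc m)) u       = qmul-+-qmul-suc m u

⊠-qmul-1ᵣ : ∀ m u → u ⊠ qmul m 1ᵣ ≡ qmul m u
⊠-qmul-1ᵣ zero          (a , b) = cong₂ _,_ (even₀ a b) (even₁ a b)
  where even₀ : ∀ a b → a * + 1 + b * + 0 ≡ a
        even₀ = solve-∀
        even₁ : ∀ a b → a * + 0 + b * + 1 ≡ b
        even₁ = solve-∀
⊠-qmul-1ᵣ (suc zero)    (a , b) = cong₂ _,_ (odd₀ a b) (odd₁ a b)
  where odd₀ : ∀ a b → a * + 0 + b * + 1 ≡ b
        odd₀ = solve-∀
        odd₁ : ∀ a b → a * + 1 + b * + 0 ≡ a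
        odd₁ = solve-∀
⊠-qmul-1ᵣ (suc (suc m)) u       = ⊠-qmul-1ᵣ m u

-- The residue homomorphism ℤ[q] → ℤ[q]/(q² - 1)

-- tails f has j-th coefficient f_j + f_{j+2} + f_{j+4} + ⋯
tails : Poly → Poly
tails []      = []
tails (a ∷ f) = (a + coeff (tails f) 1) ∷ tails f

tails-step : ∀ f j → coeff (tails f) j ≡ coeff f j + coeff (tails f) (suc (suc j))
tails-step []      j       = refl
tails-step (a ∷ f) zero    = refl
tails-step (a ∷ f) (suc j) = tails-step f j

-- (sum of even coefficients , sum of odd coefficients)
residue : Poly → Residue
residue f = coeff (tails f) 0 , coeff (tails f) 1

residue-shift : ∀ f → residue (+ 0 ∷ f) ≡ swap (residue f)
residue-shift f = cong (_, coeff (tails f) 0) (+-identityˡ _)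

residue-⊕ : ∀ f g → residue (f ⊕ g) ≡ residue f ⊞ residue g
residue-⊕ []      g       = sym (⊞-identityˡ (residue g))
residue-⊕ (a ∷ f) []      = sym (⊞-identityʳ (residue (a ∷ f)))
residue-⊕ (a ∷ f) (b ∷ g) = cong₂ _,_
  (trans (cong (_+_ (a + b)) (cong proj₂ (residue-⊕ f g)))
         (interchange a b (proj₂ (residue f)) (proj₂ (residue g))))
  (cong proj₁ (residue-⊕ f g))
  where interchange : ∀ a b x y → a + b + (x + y) ≡ a + x + (b + y)
        interchange = solve-∀

residue-scale : ∀ c g → residue (scale c g) ≡ c ·ᵣ residue g
residue-scale c []      = cong₂ _,_ (sym (*-zeroʳ c)) (sym (*-zeroʳ c))
residue-scale c (a ∷ g) = cong₂ _,_
  (trans (cong (_+_ (c * a)) (cong proj₂ (residue-scale c g))) (sym (*-distribˡ-+ c a _)))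
  (cong proj₁ (residue-scale c g))

residue-⊗ : ∀ f g → residue (f ⊗ g) ≡ residue f ⊠ residue g
residue-⊗ []      g = sym (⊠-zeroˡ (residue g))
residue-⊗ (a ∷ f) g = begin
  residue (scale a g ⊕ (+ 0 ∷ f ⊗ g))
    ≡⟨ residue-⊕ (scale a g) (+ 0 ∷ f ⊗ g) ⟩
  residue (scale a g) ⊞ residue (+ 0 ∷ f ⊗ g)
    ≡⟨ cong₂ _⊞_ (residue-scale a g) (residue-shift (f ⊗ g)) ⟩
  a ·ᵣ residue g ⊞ swap (residue (f ⊗ g))
    ≡⟨ cong (λ v → a ·ᵣ residue g ⊞ swap v) (residue-⊗ f g) ⟩
  a ·ᵣ residue g ⊞ swap (residue f ⊠ residue g)
    ≡⟨ cons-law a (residue f) (residue g) ⟩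
  residue (a ∷ f) ⊠ residue g ∎
  where
  cons-law : ∀ a u v → a ·ᵣ v ⊞ swap (u ⊠ v) ≡ (a + proj₂ u , proj₁ u) ⊠ v
  cons-law a (b , c) (d , e) = cong₂ _,_ (law₀ a b c d e) (law₁ a b c d e)
    where law₀ : ∀ a b c d e → a * d + (b * e + c * d) ≡ (a + c) * d + b * e
          law₀ = solve-∀
          law₁ : ∀ a b c d e → a * e + (b * d + c * e) ≡ (a + c) * e + b * d
          law₁ = solve-∀

residue-qpow : ∀ m → residue (qpow m) ≡ qmul m 1ᵣ
residue-qpow zero    = refl
residue-qpow (suc m) = begin
  residue (+ 0 ∷ qpow m)  ≡⟨ residue-shift (qpow m) ⟩
  swap (residue (qpow m)) ≡⟨ cong swap (residue-qpow m) ⟩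
  swap (qmul m 1ᵣ)        ≡⟨ sym (qmul-suc m 1ᵣ) ⟩
  qmul (suc m) 1ᵣ         ∎

residue-qpow-⊗ : ∀ m f → residue (qpow m ⊗ f) ≡ qmul m (residue f)
residue-qpow-⊗ m f = begin
  residue (qpow m ⊗ f)            ≡⟨ residue-⊗ (qpow m) f ⟩
  residue (qpow m) ⊠ residue f    ≡⟨ cong (_⊠ residue f) (residue-qpow m) ⟩
  qmul m 1ᵣ ⊠ residue f           ≡⟨ ⊠-comm (qmul m 1ᵣ) (residue f) ⟩
  residue f ⊠ qmul m 1ᵣ           ≡⟨ ⊠-qmul-1ᵣ m (residue f) ⟩
  qmul m (residue f)              ∎

-- The kernel of the residue map is the ideal generated by q² - 1

q²-1ᵤ : Poly
q²-1ᵤ = - + 1 ∷ + 0 ∷ + 1 ∷ []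

coeff-q²-1-⊗ : ∀ h j → coeff (q²-1ᵤ ⊗ h) j ≡ coeff (+ 0 ∷ + 0 ∷ h) j - coeff h j
coeff-q²-1-⊗ h zero = begin
  coeff (q²-1ᵤ ⊗ h) 0        ≡⟨ coeff-cons-⊗ (- + 1) (+ 0 ∷ + 1 ∷ []) h 0 ⟩
  - + 1 * coeff h 0 + + 0     ≡⟨ negate (coeff h 0) ⟩
  + 0 - coeff h 0             ∎
  where negate : ∀ x → - + 1 * x + + 0 ≡ + 0 - x
        negate = solve-∀
coeff-q²-1-⊗ h (suc zero) = begin
  coeff (q²-1ᵤ ⊗ h) 1                               ≡⟨ coeff-cons-⊗ (- + 1) (+ 0 ∷ + 1 ∷ []) h 1 ⟩
  - + 1 * coeff h 1 + coeff ((+ 0 ∷ + 1 ∷ []) ⊗ h) 0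
    ≡⟨ cong (_+_ (- + 1 * coeff h 1)) (coeff-cons-⊗ (+ 0) (+ 1 ∷ []) h 0) ⟩
  - + 1 * coeff h 1 + (+ 0 * coeff h 0 + + 0)       ≡⟨ negate (coeff h 1) (coeff h 0) ⟩
  + 0 - coeff h 1                                   ∎
  where negate : ∀ x y → - + 1 * x + (+ 0 * y + + 0) ≡ + 0 - x
        negate = solve-∀
coeff-q²-1-⊗ h (suc (suc j)) = begin
  coeff (q²-1ᵤ ⊗ h) (suc (suc j))
    ≡⟨ coeff-cons-⊗ (- + 1) (+ 0 ∷ + 1 ∷ []) h (suc (suc j)) ⟩
  - + 1 * coeff h (suc (suc j)) + coeff ((+ 0 ∷ + 1 ∷ []) ⊗ h) (suc j)
    ≡⟨ cong (_+_ (- + 1 * coeff h (suc (suc j)))) (coeff-cons-⊗ (+ 0) (+ 1 ∷ []) h (suc j)) ⟩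
  - + 1 * coeff h (suc (suc j)) + (+ 0 * coeff h (suc j) + coeff ((+ 1 ∷ []) ⊗ h) j)
    ≡⟨ cong (λ t → - + 1 * coeff h (suc (suc j)) + (+ 0 * coeff h (suc j) + t))
            (trans (coeff-cons-⊗ (+ 1) [] h j) (cong (_+_ (+ 1 * coeff h j)) (coeff-zero j))) ⟩
  - + 1 * coeff h (suc (suc j)) + (+ 0 * coeff h (suc j) + (+ 1 * coeff h j + + 0))
    ≡⟨ rearrange (coeff h (suc (suc j))) (coeff h (suc j)) (coeff h j) ⟩
  coeff h j - coeff h (suc (suc j)) ∎
  where
  coeff-zero : ∀ j → coeff (+ 0 ∷ []) j ≡ + 0
  coeff-zero zero    = refl
  coeff-zero (suc j) = refl
  rearrange : ∀ x y z → - + 1 * x + (+ 0 * y + (+ 1 * z + + 0)) ≡ z - x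
  rearrange = solve-∀

-- the quotient (Σ_j tails_{j+2} q^j) of a polynomial in the kernel by q² - 1
quotient : Poly → Poly
quotient d = drop 2 (tails d)

coeff-quotient : ∀ d j → coeff (quotient d) j ≡ coeff (tails d) (suc (suc j))
coeff-quotient d j with tails d
... | []          = refl
... | a ∷ []      = refl
... | a ∷ b ∷ t   = refl

kernel-divisible : ∀ d → residue d ≡ 0ᵣ → ∀ j → coeff d j ≡ coeff (q²-1ᵤ ⊗ quotient d) j
kernel-divisible d d≡0 j = begin
  coeff d j                                   ≡⟨ difference (tails-step d j) ⟩
  coeff (tails d) j - coeff (tails d) (suc (suc j))
    ≡⟨ cong₂ _-_ (low-tails j) (sym (coeff-quotient d j)) ⟩
  coeff (+ 0 ∷ + 0 ∷ quotient d) j - coeff (quotient d) j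
    ≡⟨ sym (coeff-q²-1-⊗ (quotient d) j) ⟩
  coeff (q²-1ᵤ ⊗ quotient d) j                ∎
  where
  difference : ∀ {x y z} → z ≡ x + y → x ≡ z - y
  difference {x} {y} refl = cancel x y
    where cancel : ∀ x y → x ≡ x + y - y
          cancel = solve-∀
  -- the first two tails vanish since d lies in the kernel
  low-tails : ∀ j → coeff (tails d) j ≡ coeff (+ 0 ∷ + 0 ∷ quotient d) j
  low-tails zero          = cong proj₁ d≡0
  low-tails (suc zero)    = cong proj₂ d≡0
  low-tails (suc (suc j)) = sym (coeff-quotient d j)

infixl 6 _⊖_
_⊖_ : Poly → Poly → Poly
f ⊖ g = f ⊕ scale (- + 1) g

same-residue-congruent : ∀ f g → residue f ≡ residue g →
  ∀ j → coeff f j ≡ coeff g j + coeff (q²-1ᵤ ⊗ quotient (f ⊖ g)) j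
same-residue-congruent f g same j = begin
  coeff f j                              ≡⟨ rearrange (coeff f j) (coeff g j) ⟩
  coeff g j + (coeff f j + - + 1 * coeff g j)
    ≡⟨ cong (_+_ (coeff g j)) (sym (coeff-difference j)) ⟩
  coeff g j + coeff (f ⊖ g) j            ≡⟨ cong (_+_ (coeff g j)) (kernel-divisible (f ⊖ g) in-kernel j) ⟩
  coeff g j + coeff (q²-1ᵤ ⊗ quotient (f ⊖ g)) j ∎
  where
  rearrange : ∀ x y → x ≡ y + (x + - + 1 * y)
  rearrange = solve-∀
  coeff-difference : ∀ j → coeff (f ⊖ g) j ≡ coeff f j + - + 1 * coeff g j
  coeff-difference j = trans (coeff-⊕ f _ j) (cong (_+_ (coeff f j)) (coeff-scale (- + 1) g j))
  in-kernel : residue (f ⊖ g) ≡ 0ᵣ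
  in-kernel = begin
    residue (f ⊖ g)                        ≡⟨ residue-⊕ f _ ⟩
    residue f ⊞ residue (scale (- + 1) g)  ≡⟨ cong₂ _⊞_ same (residue-scale (- + 1) g) ⟩
    residue g ⊞ - + 1 ·ᵣ residue g         ≡⟨ cancel (residue g) ⟩
    0ᵣ                                     ∎
    where cancel : ∀ u → u ⊞ - + 1 ·ᵣ u ≡ 0ᵣ
          cancel (a , b) = cong₂ _,_ (cancel₁ a) (cancel₁ b)
            where cancel₁ : ∀ a → a + - + 1 * a ≡ + 0
                  cancel₁ = solve-∀

-- the row-by-row quotient of F - G by q² - 1
quotient₂ : Poly2 → Poly2 → Poly2
quotient₂ []      []      = []
quotient₂ []      (g ∷ G) = quotient ([] ⊖ g) ∷ quotient₂ [] G
quotient₂ (f ∷ F) []      = quotient (f ⊖ []) ∷ quotient₂ F []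
quotient₂ (f ∷ F) (g ∷ G) = quotient (f ⊖ g) ∷ quotient₂ F G

row-quotient₂ : ∀ F G k → row (quotient₂ F G) k ≡ quotient (row F k ⊖ row G k)
row-quotient₂ []      []      k       = refl
row-quotient₂ []      (g ∷ G) zero    = refl
row-quotient₂ []      (g ∷ G) (suc k) = row-quotient₂ [] G k
row-quotient₂ (f ∷ F) []      zero    = refl
row-quotient₂ (f ∷ F) []      (suc k) = row-quotient₂ F [] k
row-quotient₂ (f ∷ F) (g ∷ G) zero    = refl
row-quotient₂ (f ∷ F) (g ∷ G) (suc k) = row-quotient₂ F G k

coeff2-q²-1-⊗₂ : ∀ H k j → coeff2 (q²-1 ⊗₂ H) k j ≡ coeff (q²-1ᵤ ⊗ row H k) j
coeff2-q²-1-⊗₂ H k j = begin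
  coeff2 (map (q²-1ᵤ ⊗_) H ⊕₂ ([] ∷ [])) k j
    ≡⟨ coeff2-⊕₂ (map (q²-1ᵤ ⊗_) H) ([] ∷ []) k j ⟩
  coeff2 (map (q²-1ᵤ ⊗_) H) k j + coeff2 ([] ∷ []) k j
    ≡⟨ cong (_+_ (coeff2 (map (q²-1ᵤ ⊗_) H) k j)) (coeff2-zero k) ⟩
  coeff2 (map (q²-1ᵤ ⊗_) H) k j + + 0
    ≡⟨ +-identityʳ _ ⟩
  coeff2 (map (q²-1ᵤ ⊗_) H) k j
    ≡⟨ coeff2-map H k ⟩
  coeff (q²-1ᵤ ⊗ row H k) j ∎
  where
  coeff2-zero : ∀ k → coeff2 ([] ∷ []) k j ≡ + 0
  coeff2-zero zero    = refl
  coeff2-zero (suc k) = refl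
  coeff-q²-1-⊗-[] : ∀ j → coeff (q²-1ᵤ ⊗ []) j ≡ + 0
  coeff-q²-1-⊗-[] zero                = refl
  coeff-q²-1-⊗-[] (suc zero)          = refl
  coeff-q²-1-⊗-[] (suc (suc zero))    = refl
  coeff-q²-1-⊗-[] (suc (suc (suc j))) = refl
  coeff2-map : ∀ H k → coeff2 (map (q²-1ᵤ ⊗_) H) k j ≡ coeff (q²-1ᵤ ⊗ row H k) j
  coeff2-map []      k       = sym (coeff-q²-1-⊗-[] j)
  coeff2-map (h ∷ H) zero    = refl
  coeff2-map (h ∷ H) (suc k) = coeff2-map H k

congruent-if-residues-agree : ∀ F G → (∀ k → residue (row F k) ≡ residue (row G k)) →
  F ≡ G [mod-q²-1]
congruent-if-residues-agree F G same = quotient₂ F G , λ k j → begin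
  coeff2 F k j
    ≡⟨ coeff2-row F k j ⟩
  coeff (row F k) j
    ≡⟨ same-residue-congruent (row F k) (row G k) (same k) j ⟩
  coeff (row G k) j + coeff (q²-1ᵤ ⊗ quotient (row F k ⊖ row G k)) j
    ≡⟨ cong₂ _+_ (sym (coeff2-row G k j))
                 (cong (λ h → coeff (q²-1ᵤ ⊗ h) j) (sym (row-quotient₂ F G k))) ⟩
  coeff2 G k j + coeff (q²-1ᵤ ⊗ row (quotient₂ F G) k) j
    ≡⟨ cong (_+_ (coeff2 G k j)) (sym (coeff2-q²-1-⊗₂ (quotient₂ F G) k j)) ⟩
  coeff2 G k j + coeff2 (q²-1 ⊗₂ quotient₂ F G) k j
    ≡⟨ sym (coeff2-⊕₂ G (q²-1 ⊗₂ quotient₂ F G) k j) ⟩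
  coeff2 (G ⊕₂ q²-1 ⊗₂ quotient₂ F G) k j ∎

row-xsum-≤ : ∀ n (c : ℕ → Poly) k → k ≤ n → row (xsum n c) k ≡ c k
row-xsum-≤ n c k = row-applyUpTo (λ i → i) n k
  where
  row-applyUpTo : ∀ (f : ℕ → ℕ) n k → k ≤ n → row (map c (applyUpTo f (suc n))) k ≡ c (f k)
  row-applyUpTo f n       zero    _         = refl
  row-applyUpTo f (suc n) (suc k) (s≤s k≤n) = row-applyUpTo (λ i → f (suc i)) n k k≤n

row-xsum-> : ∀ n (c : ℕ → Poly) k → n < k → row (xsum n c) k ≡ []
row-xsum-> n c k = row-applyUpTo-beyond (λ i → i) (suc n) k
  where
  row-applyUpTo-beyond : ∀ (f : ℕ → ℕ) m k → m ≤ k → row (map c (applyUpTo f m)) k ≡ []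
  row-applyUpTo-beyond f zero    k       _         = refl
  row-applyUpTo-beyond f (suc m) (suc k) (s≤s m≤k) =
    row-applyUpTo-beyond (λ i → f (suc i)) m k m≤k

residue-linear : ∀ a b → residue (a ∷ b ∷ []) ≡ (a , b)
residue-linear a b = cong₂ _,_ (+-identityʳ a) (+-identityʳ b)

-- Gaussian binomial coefficients modulo q² - 1 are Losanitsch numbers

losanitsch : ℕ → ℕ → Residue
losanitsch n k = + L n k , Lbar n k

L-zero : ∀ n → L n 0 ≡ 1
L-zero zero          = refl
L-zero (suc zero)    = refl
L-zero (suc (suc n)) = L-zero n

losanitsch-zero : ∀ n → losanitsch n 0 ≡ 1ᵣ
losanitsch-zero n rewrite L-zero n = refl

total-losanitsch : ∀ n k → total (losanitsch n k) ≡ + (n C k)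
total-losanitsch n k = cancel (+ L n k) (+ (n C k))
  where cancel : ∀ l c → l + (c - l) ≡ c
        cancel = solve-∀

pascal : ∀ n k → + (suc n C suc k) ≡ + (n C k) + + (n C suc k)
pascal n k = trans (cong +_ (sym (nCk+nC[k+1]≡[n+1]C[k+1] n k))) (pos-+ (n C k) (n C suc k))

losanitsch-step₁ : ∀ m → losanitsch (suc (suc m)) 1 ≡ (+ 1 , + 1) ⊞ losanitsch m 1
losanitsch-step₁ m = cong₂ _,_
  (trans (pos-+ (L m 1) 1) (+-comm (+ L m 1) (+ 1)))
  (begin
    + (suc (suc m) C 1) - + (L m 1 ℕ.+ 1)   ≡⟨ cong₂ _-_ (cong +_ (nC1≡n (suc (suc m)))) (pos-+ (L m 1) 1) ⟩
    + suc (suc m) - (+ L m 1 + + 1)        ≡⟨ rearrange (+ m) (+ L m 1) ⟩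
    + 1 + (+ m - + L m 1)                  ≡⟨ cong (λ c → + 1 + (+ c - + L m 1)) (sym (nC1≡n m)) ⟩
    + 1 + (+ (m C 1) - + L m 1)            ∎)
  where rearrange : ∀ m l → + 1 + (+ 1 + m) - (l + + 1) ≡ + 1 + (m - l)
        rearrange = solve-∀

-- Losanitsch's recurrence at k ≥ 2; the L̄ coordinate follows from Pascal's rule twice
losanitsch-step : ∀ m j → losanitsch (suc (suc m)) (suc (suc j)) ≡
  losanitsch m j ⊞ diag (+ (m C suc j)) ⊞ losanitsch m (suc (suc j))
losanitsch-step m j = cong₂ _,_
  (trans L-split (rearrange₀ (+ L m (suc (suc j))) (+ (m C suc j)) (+ L m j)))
  (begin
    + (suc (suc m) C suc (suc j)) - + L (suc (suc m)) (suc (suc j))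
      ≡⟨ cong₂ _-_ C-split L-split ⟩
    (+ (m C j) + + (m C suc j)) + (+ (m C suc j) + + (m C suc (suc j)))
      - (+ L m (suc (suc j)) + + (m C suc j) + + L m j)
      ≡⟨ rearrange₁ (+ (m C j)) (+ (m C suc j)) (+ (m C suc (suc j)))
                    (+ L m j) (+ L m (suc (suc j))) ⟩
    Lbar m j + + (m C suc j) + Lbar m (suc (suc j)) ∎)
  where
  L-split : + L (suc (suc m)) (suc (suc j)) ≡ + L m (suc (suc j)) + + (m C suc j) + + L m j
  L-split = trans (pos-+ (L m (suc (suc j)) ℕ.+ (m C suc j)) (L m j))
                  (cong (_+ + L m j) (pos-+ (L m (suc (suc j))) (m C suc j)))
  C-split : + (suc (suc m) C suc (suc j)) ≡
            (+ (m C j) + + (m C suc j)) + (+ (m C suc j) + + (m C suc (suc j)))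
  C-split = trans (pascal (suc m) (suc j)) (cong₂ _+_ (pascal m j) (pascal m (suc j)))
  rearrange₀ : ∀ a b c → a + b + c ≡ c + b + a
  rearrange₀ = solve-∀
  rearrange₁ : ∀ c₀ c₁ c₂ l₀ l₂ → (c₀ + c₁) + (c₁ + c₂) - (l₂ + c₁ + l₀) ≡ (c₀ - l₀) + c₁ + (c₂ - l₂)
  rearrange₁ = solve-∀

residue-gauss-step : ∀ n k → residue (gauss (suc n) (suc k)) ≡
  residue (gauss n k) ⊞ qmul (suc k) (residue (gauss n (suc k)))
residue-gauss-step n k = trans (residue-⊕ (gauss n k) _)
  (cong (residue (gauss n k) ⊞_) (residue-qpow-⊗ (suc k) (gauss n (suc k))))

-- q-Pascal applied twice, simplified with q^{2(k+1)} = 1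
residue-gauss-two-step : ∀ m k → residue (gauss (suc (suc m)) (suc k)) ≡
  residue (gauss (suc m) k) ⊞ qmul (suc k) (residue (gauss m k)) ⊞ residue (gauss m (suc k))
residue-gauss-two-step m k = begin
  residue (gauss (suc (suc m)) (suc k))
    ≡⟨ residue-gauss-step (suc m) k ⟩
  x ⊞ qmul (suc k) (residue (gauss (suc m) (suc k)))
    ≡⟨ cong (λ v → x ⊞ qmul (suc k) v) (residue-gauss-step m k) ⟩
  x ⊞ qmul (suc k) (y ⊞ qmul (suc k) z)
    ≡⟨ cong (x ⊞_) (qmul-⊞ (suc k) y (qmul (suc k) z)) ⟩
  x ⊞ (qmul (suc k) y ⊞ qmul (suc k) (qmul (suc k) z))
    ≡⟨ cong (λ w → x ⊞ (qmul (suc k) y ⊞ w)) (qmul-involutive (suc k) z) ⟩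
  x ⊞ (qmul (suc k) y ⊞ z)
    ≡⟨ sym (⊞-assoc x (qmul (suc k) y) z) ⟩
  x ⊞ qmul (suc k) y ⊞ z ∎
  where
  x y z : Residue
  x = residue (gauss (suc m) k)
  y = residue (gauss m k)
  z = residue (gauss m (suc k))

residue-gauss : ∀ n k → residue (gauss n k) ≡ losanitsch n k
residue-gauss n                   zero          = sym (losanitsch-zero n)
residue-gauss zero                (suc k)       = refl
residue-gauss (suc zero)          (suc zero)    = refl
residue-gauss (suc zero)          (suc (suc k)) = begin
  residue (gauss (suc zero) (suc (suc k)))  ≡⟨ residue-gauss-step zero (suc k) ⟩
  0ᵣ ⊞ qmul (suc (suc k)) 0ᵣ                ≡⟨ ⊞-identityˡ _ ⟩
  qmul (suc (suc k)) 0ᵣ                     ≡⟨ qmul-0ᵣ k ⟩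
  0ᵣ                                        ∎
residue-gauss (suc (suc m))       (suc zero)    = begin
  residue (gauss (suc (suc m)) 1)          ≡⟨ residue-gauss-two-step m zero ⟩
  (+ 1 , + 1) ⊞ residue (gauss m 1)        ≡⟨ cong ((+ 1 , + 1) ⊞_) (residue-gauss m 1) ⟩
  (+ 1 , + 1) ⊞ losanitsch m 1             ≡⟨ sym (losanitsch-step₁ m) ⟩
  losanitsch (suc (suc m)) 1               ∎
residue-gauss (suc (suc m))       (suc (suc j)) = begin
  residue (gauss (suc (suc m)) (suc (suc j)))
    ≡⟨ residue-gauss-two-step m (suc j) ⟩
  residue (gauss (suc m) (suc j)) ⊞ qmul (suc (suc j)) y ⊞ z
    ≡⟨ cong (λ u → u ⊞ qmul (suc (suc j)) y ⊞ z) (residue-gauss-step m j) ⟩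
  x ⊞ qmul (suc j) y ⊞ qmul (suc (suc j)) y ⊞ z
    ≡⟨ cong (_⊞ z) (⊞-assoc x (qmul (suc j) y) (qmul (suc (suc j)) y)) ⟩
  x ⊞ (qmul (suc j) y ⊞ qmul (suc (suc j)) y) ⊞ z
    ≡⟨ cong (λ w → x ⊞ w ⊞ z) (qmul-+-qmul-suc (suc j) y) ⟩
  x ⊞ diag (total y) ⊞ z
    ≡⟨ cong₂ (λ u w → u ⊞ diag (total y) ⊞ w) (residue-gauss m j) (residue-gauss m (suc (suc j))) ⟩
  losanitsch m j ⊞ diag (total y) ⊞ losanitsch m (suc (suc j))
    ≡⟨ cong (λ t → losanitsch m j ⊞ diag t ⊞ losanitsch m (suc (suc j)))
            (trans (cong total (residue-gauss m (suc j))) (total-losanitsch m (suc j))) ⟩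
  losanitsch m j ⊞ diag (+ (m C suc j)) ⊞ losanitsch m (suc (suc j))
    ≡⟨ sym (losanitsch-step m j) ⟩
  losanitsch (suc (suc m)) (suc (suc j)) ∎
  where
  x y z : Residue
  x = residue (gauss m j)
  y = residue (gauss m (suc j))
  z = residue (gauss m (suc (suc j)))

-- Subsets counted by size and parity of their sum

-- Σ_{s ∈ S, |s| = k} q^{Σ s}, computed in ℤ[q]/(q² - 1)
sizeTally : ℕ → List (List ℕ) → Residue
sizeTally k []      = 0ᵣ
sizeTally k (s ∷ S) =
  if length s ≡ᵇ k then qmul (sum s) 1ᵣ ⊞ sizeTally k S else sizeTally k S

sizeTally-++ : ∀ k S T → sizeTally k (S ++ T) ≡ sizeTally k S ⊞ sizeTally k T
sizeTally-++ k []      T = sym (⊞-identityˡ (sizeTally k T))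
sizeTally-++ k (s ∷ S) T with length s ≡ᵇ k
... | false = sizeTally-++ k S T
... | true  = trans (cong (qmul (sum s) 1ᵣ ⊞_) (sizeTally-++ k S T))
                    (sym (⊞-assoc (qmul (sum s) 1ᵣ) (sizeTally k S) (sizeTally k T)))

sizeTally-adjoin : ∀ a k S → sizeTally (suc k) (map (a ∷_) S) ≡ qmul a (sizeTally k S)
sizeTally-adjoin a k []      = sym (qmul-0ᵣ a)
sizeTally-adjoin a k (s ∷ S) with length s ≡ᵇ k
... | false = sizeTally-adjoin a k S
... | true  = begin
  qmul (a ℕ.+ sum s) 1ᵣ ⊞ sizeTally (suc k) (map (a ∷_) S)
    ≡⟨ cong₂ _⊞_ (qmul-+ a (sum s) 1ᵣ) (sizeTally-adjoin a k S) ⟩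
  qmul a (qmul (sum s) 1ᵣ) ⊞ qmul a (sizeTally k S)
    ≡⟨ sym (qmul-⊞ a (qmul (sum s) 1ᵣ) (sizeTally k S)) ⟩
  qmul a (qmul (sum s) 1ᵣ ⊞ sizeTally k S) ∎

sizeTally-adjoin-empty : ∀ a S → sizeTally 0 (map (a ∷_) S) ≡ 0ᵣ
sizeTally-adjoin-empty a []      = refl
sizeTally-adjoin-empty a (s ∷ S) = sizeTally-adjoin-empty a S

-- the coefficient of x^k in Σ_{s ⊆ {1,…,n}} x^{|s|} q^{Σ s}, modulo q² - 1
subsetTally : ℕ → ℕ → Residue
subsetTally n k = sizeTally k (subsets n)

-- only the empty set has size 0, and it stays the only one
subsetTally-zero : ∀ n → subsetTally (suc n) 0 ≡ subsetTally n 0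
subsetTally-zero n = begin
  sizeTally 0 (subsets n ++ map (suc n ∷_) (subsets n))
    ≡⟨ sizeTally-++ 0 (subsets n) _ ⟩
  subsetTally n 0 ⊞ sizeTally 0 (map (suc n ∷_) (subsets n))
    ≡⟨ cong (subsetTally n 0 ⊞_) (sizeTally-adjoin-empty (suc n) (subsets n)) ⟩
  subsetTally n 0 ⊞ 0ᵣ
    ≡⟨ ⊞-identityʳ (subsetTally n 0) ⟩
  subsetTally n 0 ∎

-- a (k+1)-subset of {1,…,n+1} either avoids n+1 or is a k-subset of {1,…,n} plus n+1
subsetTally-step : ∀ n k → subsetTally (suc n) (suc k) ≡
  subsetTally n (suc k) ⊞ qmul (suc n) (subsetTally n k)
subsetTally-step n k = trans (sizeTally-++ (suc k) (subsets n) _)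
  (cong (subsetTally n (suc k) ⊞_) (sizeTally-adjoin (suc n) k (subsets n)))

subsetTally-vanishes : ∀ n k → n < k → subsetTally n k ≡ 0ᵣ
subsetTally-vanishes zero    (suc k) _         = refl
subsetTally-vanishes (suc n) (suc k) (s≤s n<k) = begin
  subsetTally (suc n) (suc k)
    ≡⟨ subsetTally-step n k ⟩
  subsetTally n (suc k) ⊞ qmul (suc n) (subsetTally n k)
    ≡⟨ cong₂ (λ u v → u ⊞ qmul (suc n) v)
             (subsetTally-vanishes n (suc k) (m<n⇒m<1+n n<k)) (subsetTally-vanishes n k n<k) ⟩
  0ᵣ ⊞ qmul (suc n) 0ᵣ
    ≡⟨ trans (⊞-identityˡ _) (qmul-0ᵣ (suc n)) ⟩
  0ᵣ ∎

parityCounts : ℕ → List (List ℕ) → Residue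
parityCounts k S =
  + length (filter (λ s → (length s ≟ k) ×-dec (sum s % 2 ≟ 0)) S) ,
  + length (filter (λ s → (length s ≟ k) ×-dec (sum s % 2 ≟ 1)) S)

-- q^t reduces to 1 or q by the parity of t, so the tally counts by parity
parityCounts-tally : ∀ k S → parityCounts k S ≡ sizeTally k S
parityCounts-tally k []      = refl
parityCounts-tally k (s ∷ S) with length s ≡ᵇ k
... | false = parityCounts-tally k S
... | true rewrite qmul-mod2 (sum s) 1ᵣ with sum s % 2 | m%n<n (sum s) 2
...   | 0           | _                 = cong (1ᵣ ⊞_) (parityCounts-tally k S)
...   | 1           | _                 = cong (swap 1ᵣ ⊞_) (parityCounts-tally k S)
...   | suc (suc _) | s≤s (s≤s ())

eo-tally : ∀ n k → (+ e n k , + o n k) ≡ subsetTally n k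
eo-tally n k = parityCounts-tally k (subsets n)

-- The product p_n = ∏_{j ≤ n} (1 + q^j x) modulo q² - 1

residue-row-⊕₂ : ∀ A B k → residue (row (A ⊕₂ B) k) ≡ residue (row A k) ⊞ residue (row B k)
residue-row-⊕₂ []      B       k       = sym (⊞-identityˡ _)
residue-row-⊕₂ (f ∷ A) []      k       = sym (⊞-identityʳ _)
residue-row-⊕₂ (f ∷ A) (g ∷ B) zero    = residue-⊕ f g
residue-row-⊕₂ (f ∷ A) (g ∷ B) (suc k) = residue-row-⊕₂ A B k

module MultiplyByLinear (c d : Poly) where

  residue-row-zero : ∀ F → residue (row (F ⊗₂ (c ∷ d ∷ [])) 0) ≡ residue (row F 0) ⊠ residue c
  residue-row-zero []      = sym (⊠-zeroˡ (residue c))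
  residue-row-zero (f ∷ F) = begin
    residue (row (map (f ⊗_) (c ∷ d ∷ []) ⊕₂ ([] ∷ F ⊗₂ (c ∷ d ∷ []))) 0)
      ≡⟨ residue-row-⊕₂ (map (f ⊗_) (c ∷ d ∷ [])) ([] ∷ F ⊗₂ (c ∷ d ∷ [])) 0 ⟩
    residue (f ⊗ c) ⊞ 0ᵣ  ≡⟨ ⊞-identityʳ _ ⟩
    residue (f ⊗ c)       ≡⟨ residue-⊗ f c ⟩
    residue f ⊠ residue c ∎

  residue-row-suc : ∀ F k → residue (row (F ⊗₂ (c ∷ d ∷ [])) (suc k)) ≡
    residue (row F (suc k)) ⊠ residue c ⊞ residue (row F k) ⊠ residue d
  residue-row-suc [] k = sym (trans (cong₂ _⊞_ (⊠-zeroˡ (residue c)) (⊠-zeroˡ (residue d)))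
                                    (⊞-identityˡ 0ᵣ))
  residue-row-suc (f ∷ F) zero = begin
    residue (row (map (f ⊗_) (c ∷ d ∷ []) ⊕₂ ([] ∷ F ⊗₂ (c ∷ d ∷ []))) 1)
      ≡⟨ residue-row-⊕₂ (map (f ⊗_) (c ∷ d ∷ [])) ([] ∷ F ⊗₂ (c ∷ d ∷ [])) 1 ⟩
    residue (f ⊗ d) ⊞ residue (row (F ⊗₂ (c ∷ d ∷ [])) 0)
      ≡⟨ cong₂ _⊞_ (residue-⊗ f d) (residue-row-zero F) ⟩
    residue f ⊠ residue d ⊞ residue (row F 0) ⊠ residue c
      ≡⟨ ⊞-comm (residue f ⊠ residue d) (residue (row F 0) ⊠ residue c) ⟩
    residue (row F 0) ⊠ residue c ⊞ residue f ⊠ residue d ∎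
  residue-row-suc (f ∷ F) (suc k) = begin
    residue (row (map (f ⊗_) (c ∷ d ∷ []) ⊕₂ ([] ∷ F ⊗₂ (c ∷ d ∷ []))) (suc (suc k)))
      ≡⟨ residue-row-⊕₂ (map (f ⊗_) (c ∷ d ∷ [])) ([] ∷ F ⊗₂ (c ∷ d ∷ [])) (suc (suc k)) ⟩
    0ᵣ ⊞ residue (row (F ⊗₂ (c ∷ d ∷ [])) (suc k))
      ≡⟨ ⊞-identityˡ _ ⟩
    residue (row (F ⊗₂ (c ∷ d ∷ [])) (suc k))
      ≡⟨ residue-row-suc F k ⟩
    residue (row F (suc k)) ⊠ residue c ⊞ residue (row F k) ⊠ residue d ∎

residue-pPoly : ∀ n k → residue (row (pPoly n) k) ≡ subsetTally n k
residue-pPoly zero    zero    = refl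
residue-pPoly zero    (suc k) = refl
residue-pPoly (suc n) zero    = begin
  residue (row (pPoly (suc n)) 0)     ≡⟨ residue-row-zero (pPoly n) ⟩
  residue (row (pPoly n) 0) ⊠ 1ᵣ      ≡⟨ ⊠-qmul-1ᵣ 0 (residue (row (pPoly n) 0)) ⟩
  residue (row (pPoly n) 0)           ≡⟨ residue-pPoly n 0 ⟩
  subsetTally n 0                     ≡⟨ sym (subsetTally-zero n) ⟩
  subsetTally (suc n) 0               ∎
  where open MultiplyByLinear (const (+ 1)) (qpow (suc n))
residue-pPoly (suc n) (suc k) = begin
  residue (row (pPoly (suc n)) (suc k))
    ≡⟨ residue-row-suc (pPoly n) k ⟩
  residue (row (pPoly n) (suc k)) ⊠ 1ᵣ ⊞ residue (row (pPoly n) k) ⊠ residue (qpow (suc n))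
    ≡⟨ cong₂ _⊞_ (⊠-qmul-1ᵣ 0 (residue (row (pPoly n) (suc k))))
         (trans (cong (residue (row (pPoly n) k) ⊠_) (residue-qpow (suc n)))
                (⊠-qmul-1ᵣ (suc n) (residue (row (pPoly n) k)))) ⟩
  residue (row (pPoly n) (suc k)) ⊞ qmul (suc n) (residue (row (pPoly n) k))
    ≡⟨ cong₂ (λ u v → u ⊞ qmul (suc n) v) (residue-pPoly n (suc k)) (residue-pPoly n k) ⟩
  subsetTally n (suc k) ⊞ qmul (suc n) (subsetTally n k)
    ≡⟨ sym (subsetTally-step n k) ⟩
  subsetTally (suc n) (suc k) ∎
  where open MultiplyByLinear (const (+ 1)) (qpow (suc n))

LPoly-residues : ∀ n k → residue (row (LPoly n) k) ≡ residue (row (rogersSzego n) k)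
LPoly-residues n k with k ≤? n
... | yes k≤n = begin
  residue (row (LPoly n) k)            ≡⟨ cong residue (row-xsum-≤ n _ k k≤n) ⟩
  residue (+ L n k ∷ Lbar n k ∷ [])    ≡⟨ residue-linear (+ L n k) (Lbar n k) ⟩
  losanitsch n k                       ≡⟨ sym (residue-gauss n k) ⟩
  residue (gauss n k)                  ≡⟨ cong residue (sym (row-xsum-≤ n (gauss n) k k≤n)) ⟩
  residue (row (rogersSzego n) k)      ∎
... | no k≰n = cong residue
  (trans (row-xsum-> n _ k (≰⇒> k≰n)) (sym (row-xsum-> n (gauss n) k (≰⇒> k≰n))))

eoPoly-residues : ∀ n k → residue (row (eoPoly n) k) ≡ residue (row (pPoly n) k)
eoPoly-residues n k with k ≤? n
... | yes k≤n = begin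
  residue (row (eoPoly n) k)           ≡⟨ cong residue (row-xsum-≤ n _ k k≤n) ⟩
  residue (+ e n k ∷ + o n k ∷ [])     ≡⟨ residue-linear (+ e n k) (+ o n k) ⟩
  (+ e n k , + o n k)                  ≡⟨ eo-tally n k ⟩
  subsetTally n k                      ≡⟨ sym (residue-pPoly n k) ⟩
  residue (row (pPoly n) k)            ∎
... | no k≰n = begin
  residue (row (eoPoly n) k)           ≡⟨ cong residue (row-xsum-> n _ k (≰⇒> k≰n)) ⟩
  0ᵣ                                   ≡⟨ sym (subsetTally-vanishes n k (≰⇒> k≰n)) ⟩
  subsetTally n k                      ≡⟨ sym (residue-pPoly n k) ⟩
  residue (row (pPoly n) k)            ∎

corollary4p2 : (n : ℕ) →
    (LPoly n ≡ rogersSzego n [mod-q²-1]) × (eoPoly n ≡ pPoly n [mod-q²-1])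
corollary4p2 n =
  congruent-if-residues-agree (LPoly n) (rogersSzego n) (LPoly-residues n) ,
  congruent-if-residues-agree (eoPoly n) (pPoly n) (eoPoly-residues n)
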